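{- If $\Gamma\vdash A$ is derivable and $\Gamma\leqslant\Sigma$, then $\Sigma\vdash A$ is derivable. If $\Gamma\vdash S\triangleright\Delta$ is derivable and $\Gamma\leqslant\Sigma$, then $\Sigma\vdash S\triangleright\Psi$ is derivable for some context $\Psi\geqslant\Delta$.
   Context: Variables $x,y,z,\ldots$; $\mathsf{x},\mathsf{y},\mathsf{z}$ range over variables. Terms and substitutions of $\lambda\alpha$: $A,B::=\mathsf{x}\mid AB\mid\lambda\mathsf{x}.A\mid S\circ A$, $S::=[B/\mathsf{x}]\mid W\mathsf{x}\mid\{\mathsf{y}\mathsf{x}\}\mid S_{\mathsf{x}}$. A context $\Gamma$ is a pair $G,L$ of a finite set $G$ of variables and a finite list $L$ of variables with repetitions allowed; $\mathsf{x}\in\Gamma$ means $\mathsf{x}\in G$ or $\mathsf{x}$ occurs in $L$; $\Gamma,\mathsf{x}$ denotes $G,(L,\mathsf{x})$; a context with empty list is written $G$. Derivable judgements: $G\vdash\mathsf{x}$ if $\mathsf{x}\in G$; $\Gamma,\mathsf{x}\vdash\mathsf{x}$; from $\Gamma\vdash\mathsf{x}$ infer $\Gamma,\mathsf{y}\vdash\mathsf{x}$ ($\mathsf{x}\neq\mathsf{y}$); from $\Gamma\vdash A$, $\Gamma\vdash B$ infer $\Gamma\vdash AB$; from $\Gamma,\mathsf{x}\vdash A$ infer $\Gamma\vdash\lambda\mathsf{x}.A$; from $\Gamma\vdash S\triangleright\Delta$, $\Delta\vdash A$ infer $\Gamma\vdash S\circ A$; from $\Gamma\vdash B$ infer $\Gamma\vdash[B/\mathsf{x}]\triangleright\Gamma,\mathsf{x}$;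 $\Gamma,\mathsf{x}\vdash W\mathsf{x}\triangleright\Gamma$; $\Gamma,\mathsf{y}\vdash\{\mathsf{y}\mathsf{x}\}\triangleright\Gamma,\mathsf{x}$; from $\Gamma\vdash S\triangleright\Delta$ infer $\Gamma,\mathsf{x}\vdash S_{\mathsf{x}}\triangleright\Delta,\mathsf{x}$. The order $\leqslant$ on contexts is the least partial order such that $G,L<G\cup\{\mathsf{x}\},L$ whenever $\mathsf{x}\notin G$, and $G,L<(G\setminus\{\mathsf{x}\}),L'$ where $L'$ is the list $\mathsf{x}$ followed by $L$. -}

module Defs where

open import Data.Nat using (ℕ)
open import Data.List using (List; []; _∷_; _∷ʳ_)
open import Data.List.Membership.Propositional using (_∈_; _∉_)
open import Data.Product using (_×_; Σ)
open import Data.Sum using (_⊎_)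
open import Relation.Binary.PropositionalEquality using (_≡_; _≢_)
open import Relation.Binary.Construct.Closure.ReflexiveTransitive using (Star)

Var : Set
Var = ℕ

mutual
  data Term : Set where
    var : Var → Term
    app : Term → Term → Term
    lam : Var → Term → Term
    _∘_ : Subst → Term → Term

  data Subst : Set where
    [_/_] : Term → Var → Subst
    W     : Var → Subst
    swap  : Var → Var → Subst       -- {y x}   written swap y x
    lift  : Subst → Var → Subst     -- S_x

-- A context is a pair G , L : G a finite set of variables (represented by a
-- list, read as the set of its elements), L a list of variables (repetitions
-- allowed).  The list L is extended on the right: Γ , x = G , (L , x).
record Ctx : Set where
  constructor ⟨_,_⟩
  field
    G : List Var
    L : List Var   -- stored in reverse: head of the list = last (rightmost) entry
open Ctx public

_▸_ : Ctx → Var → Ctx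
⟨ g , l ⟩ ▸ x = ⟨ g , x ∷ l ⟩

mutual
  data _⊢_ : Ctx → Term → Set where
    ax-G   : ∀ {g x} → x ∈ g → ⟨ g , [] ⟩ ⊢ var x
    ax-L   : ∀ {Γ x} → (Γ ▸ x) ⊢ var x
    weak   : ∀ {Γ x y} → Γ ⊢ var x → x ≢ y → (Γ ▸ y) ⊢ var x
    ⊢app   : ∀ {Γ A B} → Γ ⊢ A → Γ ⊢ B → Γ ⊢ app A B
    ⊢lam   : ∀ {Γ x A} → (Γ ▸ x) ⊢ A → Γ ⊢ lam x A
    ⊢sub   : ∀ {Γ Δ S A} → Γ ⊢ S ▷ Δ → Δ ⊢ A → Γ ⊢ (S ∘ A)

  data _⊢_▷_ : Ctx → Subst → Ctx → Set where
    ⊢[/]   : ∀ {Γ B x} → Γ ⊢ B → Γ ⊢ [ B / x ] ▷ (Γ ▸ x)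
    ⊢W     : ∀ {Γ x} → (Γ ▸ x) ⊢ W x ▷ Γ
    ⊢swap  : ∀ {Γ x y} → (Γ ▸ y) ⊢ swap y x ▷ (Γ ▸ x)
    ⊢lift  : ∀ {Γ Δ S x} → Γ ⊢ S ▷ Δ → (Γ ▸ x) ⊢ lift S x ▷ (Δ ▸ x)

_≈Insert_,_ : List Var → List Var → Var → Set
g' ≈Insert g , x = ∀ y → (y ∈ g' → (y ∈ g ⊎ y ≡ x)) × ((y ∈ g ⊎ y ≡ x) → y ∈ g')

_≈Remove_,_ : List Var → List Var → Var → Set
g' ≈Remove g , x = ∀ y → (y ∈ g' → (y ∈ g × y ≢ x)) × ((y ∈ g × y ≢ x) → y ∈ g')

_≈Set_ : List Var → List Var → Set
g ≈Set g' = ∀ y → (y ∈ g → y ∈ g') × (y ∈ g' → y ∈ g)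

-- Generating steps of the order on contexts (plus identification of
-- contexts representing the same pair (set, list)).
data Step : Ctx → Ctx → Set where
  same   : ∀ {g g' l} → g ≈Set g' → Step ⟨ g , l ⟩ ⟨ g' , l ⟩
  add    : ∀ {g g' l x} → x ∉ g → g' ≈Insert g , x → Step ⟨ g , l ⟩ ⟨ g' , l ⟩
  -- G , L < G ∖ {x} , L'  where L' is x followed by L (x is the leftmost,
  -- i.e. last in our reversed representation)
  move   : ∀ {g g' l x} → g' ≈Remove g , x → Step ⟨ g , l ⟩ ⟨ g' , l ∷ʳ x ⟩

_⩽_ : Ctx → Ctx → Set
_⩽_ = Star Step

module Submission where

-- The proof is a simultaneous induction on derivations of Γ ⊢ A and
-- Γ ⊢ S ▷ Δ, resting on three facts about contexts:
--   * a variable judgement Γ ⊢ x holds exactly when x occurs in Γ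
--     (in the set G or in the list L), and every step of the order keeps
--     the occurring variables, so variable judgements are transported;
--   * extending by a variable on the right is monotone: Γ ⩽ Σ implies
--     Γ , x ⩽ Σ , x, which handles binders and the targets of [B/x] and S_x;
--   * conversely the order never touches the rightmost list entry: every
--     Σ ⩾ Γ , x has the form Σ' , x with Γ ⩽ Σ', which handles the
--     substitutions W x, {y x} and S_x whose source context ends in a variable.
-- Applications and λ-abstractions then go through directly, and S ∘ A uses
-- the larger target context Ψ ⩾ Δ produced for S to weaken A.

open import Defs
open import Data.Product using (_×_; Σ; _,_; proj₁; proj₂)
open import Data.Sum using (_⊎_; inj₁; inj₂)
open import Data.Nat using (_≟_)
open import Data.List using (_∷_; [])
open import Data.List.Membership.Propositional using (_∈_)
open import Data.List.Membership.Propositional.Properties using (∈-++⁺ˡ; ∈-++⁺ʳ)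
open import Data.List.Relation.Unary.Any using (here; there)
open import Relation.Binary.PropositionalEquality using (_≡_; refl)
open import Relation.Nullary using (yes; no; contradiction)
open import Relation.Binary.Construct.Closure.ReflexiveTransitive using (ε; _◅_; gmap)

_∈ᶜ_ : Var → Ctx → Set
y ∈ᶜ Γ = y ∈ G Γ ⊎ y ∈ L Γ

var-sound : ∀ {Γ y} → Γ ⊢ var y → y ∈ᶜ Γ
var-sound (ax-G y∈g) = inj₁ y∈g
var-sound ax-L = inj₂ (here refl)
var-sound (weak d _) with var-sound d
... | inj₁ y∈g = inj₁ y∈g
... | inj₂ y∈l = inj₂ (there y∈l)

var-complete : ∀ {g l y} → y ∈ᶜ ⟨ g , l ⟩ → ⟨ g , l ⟩ ⊢ var y
var-complete {l = []} (inj₁ y∈g) = ax-G y∈g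
var-complete {l = z ∷ l} {y} y∈Γ with y ≟ z
... | yes refl = ax-L
... | no y≢z = weak (var-complete (drop-last y∈Γ)) y≢z
  where
  drop-last : y ∈ᶜ ⟨ _ , z ∷ l ⟩ → y ∈ᶜ ⟨ _ , l ⟩
  drop-last (inj₁ y∈g) = inj₁ y∈g
  drop-last (inj₂ (here y≡z)) = contradiction y≡z y≢z
  drop-last (inj₂ (there y∈l)) = inj₂ y∈l

-- A single step of the order keeps every occurring variable: adding to G is
-- harmless, and a variable removed from G by `move` reappears in the list.
∈ᶜ-step : ∀ {Γ Σ' y} → Step Γ Σ' → y ∈ᶜ Γ → y ∈ᶜ Σ'
∈ᶜ-step {y = y} (same g≈g') (inj₁ y∈g) = inj₁ (proj₁ (g≈g' y) y∈g)
∈ᶜ-step {y = y} (add _ g'≈g+x) (inj₁ y∈g) = inj₁ (proj₂ (g'≈g+x y) (inj₁ y∈g))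
∈ᶜ-step {y = y} (move {x = x} g'≈g-x) (inj₁ y∈g) with y ≟ x
... | yes refl = inj₂ (∈-++⁺ʳ _ (here refl))
... | no y≢x = inj₁ (proj₂ (g'≈g-x y) (y∈g , y≢x))
∈ᶜ-step (same _) (inj₂ y∈l) = inj₂ y∈l
∈ᶜ-step (add _ _) (inj₂ y∈l) = inj₂ y∈l
∈ᶜ-step (move _) (inj₂ y∈l) = inj₂ (∈-++⁺ˡ y∈l)

∈ᶜ-⩽ : ∀ {Γ Σ' y} → Γ ⩽ Σ' → y ∈ᶜ Γ → y ∈ᶜ Σ'
∈ᶜ-⩽ ε y∈Γ = y∈Γ
∈ᶜ-⩽ (s ◅ ss) y∈Γ = ∈ᶜ-⩽ ss (∈ᶜ-step s y∈Γ)

var-⩽ : ∀ {Γ Σ' y} → Γ ⊢ var y → Γ ⩽ Σ' → Σ' ⊢ var y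
var-⩽ d Γ⩽Σ = var-complete (∈ᶜ-⩽ Γ⩽Σ (var-sound d))

-- Steps act on the set and the left end of the list only, so they commute
-- with extension on the right; hence Γ ⩽ Σ implies Γ , x ⩽ Σ , x.
▸-step : ∀ {Γ Σ' x} → Step Γ Σ' → Step (Γ ▸ x) (Σ' ▸ x)
▸-step (same g≈g') = same g≈g'
▸-step (add x∉g g'≈g+x) = add x∉g g'≈g+x
▸-step (move g'≈g-x) = move g'≈g-x

▸-⩽ : ∀ {Γ Σ' x} → Γ ⩽ Σ' → (Γ ▸ x) ⩽ (Σ' ▸ x)
▸-⩽ {x = x} = gmap (_▸ x) ▸-step

▸-step⁻¹ : ∀ {Γ Σ' x} → Step (Γ ▸ x) Σ' → Σ Ctx (λ Σ'' → (Σ' ≡ Σ'' ▸ x) × Step Γ Σ'')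
▸-step⁻¹ {⟨ _ , _ ⟩} (same g≈g') = _ , refl , same g≈g'
▸-step⁻¹ {⟨ _ , _ ⟩} (add x∉g g'≈g+x) = _ , refl , add x∉g g'≈g+x
▸-step⁻¹ {⟨ _ , _ ⟩} (move g'≈g-x) = _ , refl , move g'≈g-x

▸-⩽⁻¹ : ∀ {Γ Σ' x} → (Γ ▸ x) ⩽ Σ' → Σ Ctx (λ Σ'' → (Σ' ≡ Σ'' ▸ x) × (Γ ⩽ Σ''))
▸-⩽⁻¹ ε = _ , refl , ε
▸-⩽⁻¹ (s ◅ ss) with ▸-step⁻¹ s
... | _ , refl , s' with ▸-⩽⁻¹ ss
... | _ , Σ≡Σ'▸x , ss' = _ , Σ≡Σ'▸x , (s' ◅ ss')

mutual
  weaken-term : ∀ {Γ Σ' A} → Γ ⊢ A → Γ ⩽ Σ' → Σ' ⊢ A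
  weaken-term {A = var _} d Γ⩽Σ = var-⩽ d Γ⩽Σ
  weaken-term (⊢app a b) Γ⩽Σ = ⊢app (weaken-term a Γ⩽Σ) (weaken-term b Γ⩽Σ)
  weaken-term (⊢lam a) Γ⩽Σ = ⊢lam (weaken-term a (▸-⩽ Γ⩽Σ))
  weaken-term (⊢sub s a) Γ⩽Σ with weaken-subst s Γ⩽Σ
  ... | _ , Δ⩽Ψ , s' = ⊢sub s' (weaken-term a Δ⩽Ψ)

  weaken-subst : ∀ {Γ Δ Σ' S} → Γ ⊢ S ▷ Δ → Γ ⩽ Σ' → Σ Ctx (λ Ψ → (Δ ⩽ Ψ) × (Σ' ⊢ S ▷ Ψ))
  weaken-subst (⊢[/] b) Γ⩽Σ = _ , ▸-⩽ Γ⩽Σ , ⊢[/] (weaken-term b Γ⩽Σ)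
  weaken-subst ⊢W Γ▸x⩽Σ with ▸-⩽⁻¹ Γ▸x⩽Σ
  ... | _ , refl , Γ⩽Σ' = _ , Γ⩽Σ' , ⊢W
  weaken-subst ⊢swap Γ▸y⩽Σ with ▸-⩽⁻¹ Γ▸y⩽Σ
  ... | _ , refl , Γ⩽Σ' = _ , ▸-⩽ Γ⩽Σ' , ⊢swap
  weaken-subst (⊢lift s) Γ▸x⩽Σ with ▸-⩽⁻¹ Γ▸x⩽Σ
  ... | _ , refl , Γ⩽Σ' with weaken-subst s Γ⩽Σ'
  ... | _ , Δ⩽Ψ , s' = _ , ▸-⩽ Δ⩽Ψ , ⊢lift s'

mainTheorem8 : (∀ {Γ Σ' A} → Γ ⊢ A → Γ ⩽ Σ' → Σ' ⊢ A)
    × (∀ {Γ Δ Σ' S} → Γ ⊢ S ▷ Δ → Γ ⩽ Σ' → Σ Ctx (λ Ψ → (Δ ⩽ Ψ) × (Σ' ⊢ S ▷ Ψ)))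
mainTheorem8 = weaken-term , weaken-subst
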